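{- For every integer $k\ge 3$, the coefficient $C_{k,k-2}$ of $\rho^{k-2}$ in the generalized cosecant number $c_{\rho,k}$ is $$C_{k,k-2}=\frac{21k+17}{175\cdot (3!)^{k+1}\,(k-3)!}.$$
   Context: For a complex parameter $\rho$, the generalized cosecant numbers $c_{\rho,k}$ ($k=0,1,2,\dots$) are the coefficients of the power series expansion about $z=0$ of $(z/\sin z)^{\rho}$ (principal branch, equal to $1$ at $z=0$): $(z/\sin z)^{\rho}=\sum_{k\ge 0}c_{\rho,k}z^{2k}$. Equivalently, $c_{\rho,k}=(-1)^k\sum (-1)^{N}(\rho)_{N}\prod_{i=1}^k\big(\tfrac{1}{(2i+1)!}\big)^{\lambda_i}\tfrac{1}{\lambda_i!}$, the sum running over all tuples of nonnegative integers $(\lambda_1,\dots,\lambda_k)$ with $\sum_i i\lambda_i=k$, where $N=\sum_i\lambda_i$ and $(\rho)_N=\Gamma(\rho+N)/\Gamma(\rho)$. For $k\ge1$, $c_{\rho,k}$ is a polynomial in $\rho$ of degree $k$ with zero constant term; write $c_{\rho,k}=\sum_{i=1}^k C_{k,i}\rho^i$. -}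

module Defs where

open import Data.Nat as ℕ using (ℕ; zero; suc; _∸_; _!; _≤?_)
open import Data.Nat.Properties using (_!≢0; m^n≢0)
open import Data.Integer as ℤ using (ℤ; +_)
open import Data.Rational using (ℚ; 0ℚ; 1ℚ; _+_; _*_; -_; _/_)
open import Data.List using (List; []; _∷_; map; concatMap; upTo; foldr; length)
open import Relation.Nullary.Decidable using (yes; no)

inv! : ℕ → ℚ
inv! n = (+ 1) / (n !)
  where instance _ = n !≢0

-- 1 / 6^m   (6 = 3!)
inv6^ : ℕ → ℚ
inv6^ m = (+ 1) / (6 ℕ.^ m)
  where instance _ = m^n≢0 6 m

_^ℚ_ : ℚ → ℕ → ℚ
q ^ℚ zero  = 1ℚ
q ^ℚ suc n = q * (q ^ℚ n)

-- Polynomials over ℚ as coefficient lists (index = degree)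

Poly : Set
Poly = List ℚ

_+P_ : Poly → Poly → Poly
[]       +P q        = q
(a ∷ p)  +P []       = a ∷ p
(a ∷ p)  +P (b ∷ q)  = (a + b) ∷ (p +P q)

scale : ℚ → Poly → Poly
scale c = map (c *_)

mulXplus : ℚ → Poly → Poly
mulXplus c p = (0ℚ ∷ p) +P scale c p

coeff : ℕ → Poly → ℚ
coeff i       []      = 0ℚ
coeff zero    (a ∷ p) = a
coeff (suc i) (a ∷ p) = coeff i p

pochhammer : ℕ → Poly
pochhammer zero    = 1ℚ ∷ []
pochhammer (suc n) = mulXplus ((+ n) / 1) (pochhammer n)

-- Tuples (λ_s, …, λ_{s+len-1}) of naturals with Σ_t (s+t) λ_{s+t} = target

tuples : (s len target : ℕ) → List (List ℕ)
tuples s zero    zero       = [] ∷ []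
tuples s zero    (suc _)    = []
tuples s (suc len) target =
  concatMap (λ a → choose a (s ℕ.* a ≤? target)) (upTo (suc target))
  where
  choose : (a : ℕ) → _ → List (List ℕ)
  choose a (yes _) = map (a ∷_) (tuples (suc s) len (target ∸ s ℕ.* a))
  choose a (no _)  = []

total : List ℕ → ℕ
total = foldr ℕ._+_ 0

weight : ℕ → List ℕ → ℚ
weight s []       = 1ℚ
weight s (a ∷ as) = (inv! (2 ℕ.* s ℕ.+ 1) ^ℚ a) * inv! a * weight (suc s) as

sign : ℕ → ℚ
sign n = (- 1ℚ) ^ℚ n

sumP : List Poly → Poly
sumP = foldr _+P_ []

-- c_{ρ,k} as a polynomial in ρ:
-- (-1)^k Σ_{λ_1+2λ_2+…+kλ_k = k} (-1)^N (ρ)_N Π_i (1/(2i+1)!)^{λ_i} / λ_i!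
cosecPoly : ℕ → Poly
cosecPoly k = scale (sign k)
  (sumP (map (λ lam → scale (sign (total lam) * weight 1 lam) (pochhammer (total lam)))
             (tuples 1 k k)))

C : ℕ → ℕ → ℚ
C k i = coeff i (cosecPoly k)

-- The coefficient of ρ^(k-2) in (ρ)_N vanishes unless N ≥ k - 2, and Σ i λᵢ = k
-- forces 2N ≤ k + λ₁, so only tuples with λ₁ ≥ k - 4 contribute. These are (k), (k-2, 1),
-- (k-3, 0, 1), (k-4, 2) and (k-4, 0, 0, 1); the last has N = k - 3 and contributes nothing.
-- The others need the coefficient of ρ^(k-2) in (ρ)_{k-2}, (ρ)_{k-1}, (ρ)_k, namely 1,
-- (k-2)(k-1)/2 and (k-2)(k-1)k(3k-1)/24 (Stirling numbers of the first kind), and the four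
-- contributions add up to the stated value. The case k = 3 is a direct computation.

module Submission where

open import Defs
open import Data.Nat as ℕ using (ℕ; zero; suc; _≤_; _<_; _∸_; _≤?_; s≤s; z≤n; NonZero)
import Data.Nat.Properties as ℕₚ
open import Data.Integer as ℤ using (+_)
import Data.Integer.Properties as ℤₚ
open import Data.Rational using (ℚ; 0ℚ; 1ℚ; _+_; _*_; -_; _/_; toℚᵘ)
open import Data.Rational.Properties
  using (toℚᵘ-injective; toℚᵘ-fromℚᵘ; toℚᵘ-homo-+; toℚᵘ-homo-*; +-*-commutativeRing; _≟_;
         +-assoc; +-identityˡ; +-identityʳ; *-identityˡ; *-identityʳ; *-zeroˡ; *-zeroʳ; *-distribʳ-+; *-comm; *-assoc)
open import Data.Rational.Unnormalised as ℚᵘ using (mkℚᵘ; *≡*) renaming (_≃_ to _≃ᵘ_)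
import Data.Rational.Unnormalised.Properties as ℚᵘₚ
open import Data.List using (List; []; _∷_; [_]; _++_; map; foldr; concatMap; upTo; replicate)
import Data.List.Properties as List
open import Data.List.Relation.Unary.All as All using (All; []; _∷_)
import Data.List.Relation.Unary.All.Properties as All
open import Data.Product using (Σ; proj₁; proj₂; _,_)
open import Relation.Nullary using (Dec; yes; no; ¬_)
open import Relation.Nullary.Negation using (contradiction)
open import Relation.Nullary.Decidable using (dec⇒maybe)
open import Relation.Binary.PropositionalEquality hiding ([_])
open import Function using (_∘_; id)
open import Level using (0ℓ)
open import Tactic.RingSolver using (solve-∀)
open import Data.Nat.Tactic.RingSolver using () renaming (solve-∀ to ℕ-solve-∀)
open import Tactic.RingSolver.Core.AlmostCommutativeRing using (AlmostCommutativeRing; fromCommutativeRing)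

ℚ-ring : AlmostCommutativeRing 0ℓ 0ℓ
ℚ-ring = fromCommutativeRing +-*-commutativeRing (λ x → dec⇒maybe (0ℚ ≟ x))

fromℕ : ℕ → ℚ
fromℕ n = (+ n) / 1

-- ⅙ = inv! 3, the factor attached to λ₁ in `weight 1`.
⅙ : ℚ
⅙ = (+ 1) / 6

toℚᵘ-/ : ∀ i d → toℚᵘ (i / suc d) ≃ᵘ mkℚᵘ i d
toℚᵘ-/ i d = toℚᵘ-fromℚᵘ (mkℚᵘ i d)

fromℕ-suc : ∀ n → fromℕ (suc n) ≡ 1ℚ + fromℕ n
fromℕ-suc n = toℚᵘ-injective (begin
  toℚᵘ (fromℕ (suc n))                 ≈⟨ toℚᵘ-/ (+ suc n) 0 ⟩
  mkℚᵘ (+ suc n) 0                     ≈⟨ *≡* (cong (ℤ._* + 1) (cong (λ z → + 1 ℤ.+ z) (sym (ℤₚ.*-identityʳ (+ n))))) ⟩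
  mkℚᵘ (+ 1) 0 ℚᵘ.+ mkℚᵘ (+ n) 0       ≈⟨ ℚᵘₚ.+-congʳ (mkℚᵘ (+ 1) 0) (ℚᵘₚ.≃-sym (toℚᵘ-/ (+ n) 0)) ⟩
  toℚᵘ 1ℚ ℚᵘ.+ toℚᵘ (fromℕ n)          ≈⟨ ℚᵘₚ.≃-sym (toℚᵘ-homo-+ 1ℚ (fromℕ n)) ⟩
  toℚᵘ (1ℚ + fromℕ n)                  ∎)
  where open ℚᵘₚ.≃-Reasoning

fromℕ-+ : ∀ m n → fromℕ (m ℕ.+ n) ≡ fromℕ m + fromℕ n
fromℕ-+ zero    n = sym (+-identityˡ (fromℕ n))
fromℕ-+ (suc m) n = begin
  fromℕ (suc (m ℕ.+ n))          ≡⟨ fromℕ-suc (m ℕ.+ n) ⟩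
  1ℚ + fromℕ (m ℕ.+ n)           ≡⟨ cong (_+_ 1ℚ) (fromℕ-+ m n) ⟩
  1ℚ + (fromℕ m + fromℕ n)       ≡⟨ sym (+-assoc 1ℚ (fromℕ m) (fromℕ n)) ⟩
  (1ℚ + fromℕ m) + fromℕ n       ≡⟨ cong (_+ fromℕ n) (sym (fromℕ-suc m)) ⟩
  fromℕ (suc m) + fromℕ n        ∎
  where open ≡-Reasoning

fromℕ-* : ∀ m n → fromℕ (m ℕ.* n) ≡ fromℕ m * fromℕ n
fromℕ-* zero    n = sym (*-zeroˡ (fromℕ n))
fromℕ-* (suc m) n = begin
  fromℕ (n ℕ.+ m ℕ.* n)              ≡⟨ fromℕ-+ n (m ℕ.* n) ⟩
  fromℕ n + fromℕ (m ℕ.* n)          ≡⟨ cong₂ _+_ (sym (*-identityˡ (fromℕ n))) (fromℕ-* m n) ⟩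
  1ℚ * fromℕ n + fromℕ m * fromℕ n   ≡⟨ sym (*-distribʳ-+ (fromℕ n) 1ℚ (fromℕ m)) ⟩
  (1ℚ + fromℕ m) * fromℕ n           ≡⟨ cong (_* fromℕ n) (sym (fromℕ-suc m)) ⟩
  fromℕ (suc m) * fromℕ n            ∎
  where open ≡-Reasoning

n/d≡n*1/d : ∀ n d → (+ n) / suc d ≡ fromℕ n * ((+ 1) / suc d)
n/d≡n*1/d n d = toℚᵘ-injective (begin
  toℚᵘ ((+ n) / suc d)                           ≈⟨ toℚᵘ-/ (+ n) d ⟩
  mkℚᵘ (+ n) d                                   ≈⟨ *≡* (cong₂ ℤ._*_ (sym (ℤₚ.*-identityʳ (+ n))) (cong (λ e → + suc e) (ℕₚ.+-identityʳ d))) ⟩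
  mkℚᵘ (+ n) 0 ℚᵘ.* mkℚᵘ (+ 1) d                 ≈⟨ ℚᵘₚ.≃-sym (ℚᵘₚ.*-cong (toℚᵘ-/ (+ n) 0) (toℚᵘ-/ (+ 1) d)) ⟩
  toℚᵘ (fromℕ n) ℚᵘ.* toℚᵘ ((+ 1) / suc d)       ≈⟨ ℚᵘₚ.≃-sym (toℚᵘ-homo-* (fromℕ n) ((+ 1) / suc d)) ⟩
  toℚᵘ (fromℕ n * ((+ 1) / suc d))               ∎)
  where open ℚᵘₚ.≃-Reasoning

1/-* : ∀ m n .{{_ : NonZero m}} .{{_ : NonZero n}} →
       _/_ (+ 1) (m ℕ.* n) {{ℕₚ.m*n≢0 m n}} ≡ ((+ 1) / m) * ((+ 1) / n)
1/-* (suc a) (suc b) = toℚᵘ-injective (begin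
  toℚᵘ ((+ 1) / (suc a ℕ.* suc b))                   ≈⟨ toℚᵘ-/ (+ 1) (b ℕ.+ a ℕ.* suc b) ⟩
  mkℚᵘ (+ 1) a ℚᵘ.* mkℚᵘ (+ 1) b                     ≈⟨ ℚᵘₚ.≃-sym (ℚᵘₚ.*-cong (toℚᵘ-/ (+ 1) a) (toℚᵘ-/ (+ 1) b)) ⟩
  toℚᵘ ((+ 1) / suc a) ℚᵘ.* toℚᵘ ((+ 1) / suc b)     ≈⟨ ℚᵘₚ.≃-sym (toℚᵘ-homo-* ((+ 1) / suc a) ((+ 1) / suc b)) ⟩
  toℚᵘ (((+ 1) / suc a) * ((+ 1) / suc b))           ∎)
  where open ℚᵘₚ.≃-Reasoning

1/n*n≡1 : ∀ n → ((+ 1) / suc n) * fromℕ (suc n) ≡ 1ℚ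
1/n*n≡1 n = toℚᵘ-injective (begin
  toℚᵘ (((+ 1) / suc n) * fromℕ (suc n))             ≈⟨ toℚᵘ-homo-* ((+ 1) / suc n) (fromℕ (suc n)) ⟩
  toℚᵘ ((+ 1) / suc n) ℚᵘ.* toℚᵘ (fromℕ (suc n))     ≈⟨ ℚᵘₚ.*-cong (toℚᵘ-/ (+ 1) n) (toℚᵘ-/ (+ suc n) 0) ⟩
  mkℚᵘ (+ 1) n ℚᵘ.* mkℚᵘ (+ suc n) 0                 ≈⟨ *≡* denominators ⟩
  toℚᵘ 1ℚ                                            ∎)
  where
  open ℚᵘₚ.≃-Reasoning
  denominators : (+ 1 ℤ.* + suc n) ℤ.* + 1 ≡ + 1 ℤ.* + suc (n ℕ.* 1)
  denominators = trans (ℤₚ.*-identityʳ _) (trans (ℤₚ.*-identityˡ (+ suc n))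
    (sym (trans (ℤₚ.*-identityˡ _) (cong (λ x → + suc x) (ℕₚ.*-identityʳ n)))))

inv!-pred : ∀ n → inv! n ≡ inv! (suc n) * fromℕ (suc n)
inv!-pred n = sym (begin
  inv! (suc n) * fromℕ (suc n)                        ≡⟨ cong (_* fromℕ (suc n)) (1/-* (suc n) (n ℕ.!) {{_}} {{n ℕₚ.!≢0}}) ⟩
  (((+ 1) / suc n) * inv! n) * fromℕ (suc n)          ≡⟨ cong (_* fromℕ (suc n)) (*-comm ((+ 1) / suc n) (inv! n)) ⟩
  (inv! n * ((+ 1) / suc n)) * fromℕ (suc n)          ≡⟨ *-assoc (inv! n) ((+ 1) / suc n) (fromℕ (suc n)) ⟩
  inv! n * (((+ 1) / suc n) * fromℕ (suc n))          ≡⟨ cong (inv! n *_) (1/n*n≡1 n) ⟩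
  inv! n * 1ℚ                                         ≡⟨ *-identityʳ (inv! n) ⟩
  inv! n                                              ∎)
  where open ≡-Reasoning

inv6^≡⅙^ : ∀ n → inv6^ n ≡ ⅙ ^ℚ n
inv6^≡⅙^ zero    = refl
inv6^≡⅙^ (suc n) = trans (1/-* 6 (6 ℕ.^ n) {{_}} {{ℕₚ.m^n≢0 6 n}}) (cong (⅙ *_) (inv6^≡⅙^ n))

sign-sq : ∀ n → sign n * sign n ≡ 1ℚ
sign-sq zero    = refl
sign-sq (suc n) = trans (swap-signs (sign n)) (sign-sq n)
  where
  swap-signs : ∀ s → (- 1ℚ * s) * (- 1ℚ * s) ≡ s * s
  swap-signs = solve-∀ ℚ-ring

sumℚ : List ℚ → ℚ
sumℚ = foldr _+_ 0ℚ

sumℚ-++ : ∀ xs ys → sumℚ (xs ++ ys) ≡ sumℚ xs + sumℚ ys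
sumℚ-++ []       ys = sym (+-identityˡ (sumℚ ys))
sumℚ-++ (x ∷ xs) ys = trans (cong (_+_ x) (sumℚ-++ xs ys)) (sym (+-assoc x (sumℚ xs) (sumℚ ys)))

sumℚ-concatMap : ∀ {A B : Set} (f : B → ℚ) (F : A → List B) xs →
                 sumℚ (map f (concatMap F xs)) ≡ sumℚ (map (λ x → sumℚ (map f (F x))) xs)
sumℚ-concatMap f F []       = refl
sumℚ-concatMap f F (x ∷ xs) = begin
  sumℚ (map f (F x ++ concatMap F xs))                       ≡⟨ cong sumℚ (List.map-++ f (F x) (concatMap F xs)) ⟩
  sumℚ (map f (F x) ++ map f (concatMap F xs))               ≡⟨ sumℚ-++ (map f (F x)) (map f (concatMap F xs)) ⟩
  sumℚ (map f (F x)) + sumℚ (map f (concatMap F xs))         ≡⟨ cong (_+_ (sumℚ (map f (F x)))) (sumℚ-concatMap f F xs) ⟩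
  sumℚ (map f (F x)) + sumℚ (map (λ x → sumℚ (map f (F x))) xs) ∎
  where open ≡-Reasoning

sumℚ-all-zero : ∀ {xs} → All (_≡ 0ℚ) xs → sumℚ xs ≡ 0ℚ
sumℚ-all-zero []         = refl
sumℚ-all-zero (x≡0 ∷ xs) = cong₂ _+_ x≡0 (sumℚ-all-zero xs)

sumℚ-upTo-suc : ∀ (g : ℕ → ℚ) n → sumℚ (map g (upTo (suc n))) ≡ sumℚ (map g (upTo n)) + g n
sumℚ-upTo-suc g n = begin
  sumℚ (map g (upTo (suc n)))                    ≡⟨ cong (sumℚ ∘ map g) (sym (List.upTo-∷ʳ n)) ⟩
  sumℚ (map g (upTo n ++ [ n ]))                 ≡⟨ cong sumℚ (List.map-++ g (upTo n) [ n ]) ⟩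
  sumℚ (map g (upTo n) ++ [ g n ])               ≡⟨ sumℚ-++ (map g (upTo n)) [ g n ] ⟩
  sumℚ (map g (upTo n)) + (g n + 0ℚ)             ≡⟨ cong (_+_ (sumℚ (map g (upTo n)))) (+-identityʳ (g n)) ⟩
  sumℚ (map g (upTo n)) + g n                    ∎
  where open ≡-Reasoning

sumℚ-upTo-shift : ∀ (g : ℕ → ℚ) m → (∀ {a} → a < m → g a ≡ 0ℚ) →
                  ∀ n → sumℚ (map g (upTo (n ℕ.+ m))) ≡ sumℚ (map (λ i → g (i ℕ.+ m)) (upTo n))
sumℚ-upTo-shift g m g<m≡0 zero    = sumℚ-all-zero (All.map⁺ (All.applyUpTo⁺₁ id m g<m≡0))
sumℚ-upTo-shift g m g<m≡0 (suc n) = begin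
  sumℚ (map g (upTo (suc (n ℕ.+ m))))                                ≡⟨ sumℚ-upTo-suc g (n ℕ.+ m) ⟩
  sumℚ (map g (upTo (n ℕ.+ m))) + g (n ℕ.+ m)                        ≡⟨ cong (_+ g (n ℕ.+ m)) (sumℚ-upTo-shift g m g<m≡0 n) ⟩
  sumℚ (map (λ i → g (i ℕ.+ m)) (upTo n)) + g (n ℕ.+ m)              ≡⟨ sym (sumℚ-upTo-suc (λ i → g (i ℕ.+ m)) n) ⟩
  sumℚ (map (λ i → g (i ℕ.+ m)) (upTo (suc n)))                      ∎
  where open ≡-Reasoning

-- Coefficients of the Pochhammer polynomials

coeff-+P : ∀ i p q → coeff i (p +P q) ≡ coeff i p + coeff i q
coeff-+P i       []      q       = sym (+-identityˡ (coeff i q))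
coeff-+P i       (a ∷ p) []      = sym (+-identityʳ (coeff i (a ∷ p)))
coeff-+P zero    (a ∷ p) (b ∷ q) = refl
coeff-+P (suc i) (a ∷ p) (b ∷ q) = coeff-+P i p q

coeff-scale : ∀ i c p → coeff i (scale c p) ≡ c * coeff i p
coeff-scale i       c []      = sym (*-zeroʳ c)
coeff-scale zero    c (a ∷ p) = refl
coeff-scale (suc i) c (a ∷ p) = coeff-scale i c p

coeff-sumP : ∀ i ps → coeff i (sumP ps) ≡ sumℚ (map (coeff i) ps)
coeff-sumP i []       = refl
coeff-sumP i (p ∷ ps) = trans (coeff-+P i p (sumP ps)) (cong (_+_ (coeff i p)) (coeff-sumP i ps))

coeff-mulXplus : ∀ i c p → coeff (suc i) (mulXplus c p) ≡ coeff i p + c * coeff (suc i) p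
coeff-mulXplus i c p = trans (coeff-+P (suc i) (0ℚ ∷ p) (scale c p)) (cong (_+_ (coeff i p)) (coeff-scale (suc i) c p))

coeff-pochhammer-suc : ∀ i N →
  coeff (suc i) (pochhammer (suc N)) ≡ coeff i (pochhammer N) + fromℕ N * coeff (suc i) (pochhammer N)
coeff-pochhammer-suc i N = coeff-mulXplus i (fromℕ N) (pochhammer N)

coeff-pochhammer-> : ∀ N i → N < i → coeff i (pochhammer N) ≡ 0ℚ
coeff-pochhammer-> zero    (suc zero)    _ = refl
coeff-pochhammer-> zero    (suc (suc i)) _ = refl
coeff-pochhammer-> (suc N) (suc i) (s≤s N<i) = begin
  coeff (suc i) (pochhammer (suc N))                           ≡⟨ coeff-pochhammer-suc i N ⟩
  coeff i (pochhammer N) + fromℕ N * coeff (suc i) (pochhammer N)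
    ≡⟨ cong₂ (λ u v → u + fromℕ N * v) (coeff-pochhammer-> N i N<i) (coeff-pochhammer-> N (suc i) (ℕₚ.m<n⇒m<1+n N<i)) ⟩
  0ℚ + fromℕ N * 0ℚ                                            ≡⟨ cong (_+_ 0ℚ) (*-zeroʳ (fromℕ N)) ⟩
  0ℚ                                                           ∎
  where open ≡-Reasoning

coeff-pochhammer-leading : ∀ n → coeff n (pochhammer n) ≡ 1ℚ
coeff-pochhammer-leading zero    = refl
coeff-pochhammer-leading (suc n) = begin
  coeff (suc n) (pochhammer (suc n))                           ≡⟨ coeff-pochhammer-suc n n ⟩
  coeff n (pochhammer n) + fromℕ n * coeff (suc n) (pochhammer n)
    ≡⟨ cong₂ (λ u v → u + fromℕ n * v) (coeff-pochhammer-leading n) (coeff-pochhammer-> n (suc n) ℕₚ.≤-refl) ⟩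
  1ℚ + fromℕ n * 0ℚ                                            ≡⟨ cong (_+_ 1ℚ) (*-zeroʳ (fromℕ n)) ⟩
  1ℚ                                                           ∎
  where open ≡-Reasoning

coeff-pochhammer-subleading : ∀ n → coeff n (pochhammer (1 ℕ.+ n)) ≡ fromℕ n * (1ℚ + fromℕ n) * inv! 2
coeff-pochhammer-subleading zero    = refl
coeff-pochhammer-subleading (suc n) = begin
  coeff (suc n) (pochhammer (2 ℕ.+ n))
    ≡⟨ coeff-pochhammer-suc n (1 ℕ.+ n) ⟩
  coeff n (pochhammer (1 ℕ.+ n)) + fromℕ (1 ℕ.+ n) * coeff (suc n) (pochhammer (1 ℕ.+ n))
    ≡⟨ cong₂ (λ u v → u + fromℕ (1 ℕ.+ n) * v) (coeff-pochhammer-subleading n) (coeff-pochhammer-leading (1 ℕ.+ n)) ⟩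
  y * (1ℚ + y) * inv! 2 + fromℕ (1 ℕ.+ n) * 1ℚ
    ≡⟨ cong (λ z → y * (1ℚ + y) * inv! 2 + z * 1ℚ) (fromℕ-suc n) ⟩
  y * (1ℚ + y) * inv! 2 + (1ℚ + y) * 1ℚ
    ≡⟨ step y ⟩
  (1ℚ + y) * (1ℚ + (1ℚ + y)) * inv! 2
    ≡⟨ cong (λ z → z * (1ℚ + z) * inv! 2) (sym (fromℕ-suc n)) ⟩
  fromℕ (suc n) * (1ℚ + fromℕ (suc n)) * inv! 2
    ∎
  where
  open ≡-Reasoning
  y = fromℕ n
  step : ∀ y → y * (1ℚ + y) * inv! 2 + (1ℚ + y) * 1ℚ ≡ (1ℚ + y) * (1ℚ + (1ℚ + y)) * inv! 2
  step = solve-∀ ℚ-ring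

coeff-pochhammer-subsubleading : ∀ n → coeff n (pochhammer (2 ℕ.+ n)) ≡
  fromℕ n * (1ℚ + fromℕ n) * (1ℚ + (1ℚ + fromℕ n)) * (fromℕ 3 * fromℕ n + fromℕ 5) * inv! 4
coeff-pochhammer-subsubleading zero    = refl
coeff-pochhammer-subsubleading (suc n) = begin
  coeff (suc n) (pochhammer (3 ℕ.+ n))
    ≡⟨ coeff-pochhammer-suc n (2 ℕ.+ n) ⟩
  coeff n (pochhammer (2 ℕ.+ n)) + fromℕ (2 ℕ.+ n) * coeff (suc n) (pochhammer (2 ℕ.+ n))
    ≡⟨ cong₂ (λ u v → u + fromℕ (2 ℕ.+ n) * v) (coeff-pochhammer-subsubleading n) (coeff-pochhammer-subleading (suc n)) ⟩
  Q y + fromℕ (2 ℕ.+ n) * (y₁ * (1ℚ + y₁) * inv! 2)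
    ≡⟨ cong (λ z → Q y + z * (y₁ * (1ℚ + y₁) * inv! 2)) (fromℕ-suc (suc n)) ⟩
  Q y + (1ℚ + y₁) * (y₁ * (1ℚ + y₁) * inv! 2)
    ≡⟨ cong (λ z → Q y + (1ℚ + z) * (z * (1ℚ + z) * inv! 2)) (fromℕ-suc n) ⟩
  Q y + (1ℚ + (1ℚ + y)) * ((1ℚ + y) * (1ℚ + (1ℚ + y)) * inv! 2)
    ≡⟨ step y ⟩
  Q (1ℚ + y)
    ≡⟨ cong Q (sym (fromℕ-suc n)) ⟩
  Q y₁
    ∎
  where
  open ≡-Reasoning
  y y₁ : ℚ
  y  = fromℕ n
  y₁ = fromℕ (suc n)
  Q : ℚ → ℚ
  Q z = z * (1ℚ + z) * (1ℚ + (1ℚ + z)) * (fromℕ 3 * z + fromℕ 5) * inv! 4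
  step : ∀ y → y * (1ℚ + y) * (1ℚ + (1ℚ + y)) * (fromℕ 3 * y + fromℕ 5) * inv! 4
                 + (1ℚ + (1ℚ + y)) * ((1ℚ + y) * (1ℚ + (1ℚ + y)) * inv! 2)
             ≡ (1ℚ + y) * (1ℚ + (1ℚ + y)) * (1ℚ + (1ℚ + (1ℚ + y))) * (fromℕ 3 * (1ℚ + y) + fromℕ 5) * inv! 4
  step = solve-∀ ℚ-ring

branch : (s l t a : ℕ) → List (List ℕ)
branch s l t a with s ℕ.* a ≤? t
... | yes _ = map (a ∷_) (tuples (suc s) l (t ∸ s ℕ.* a))
... | no  _ = []

-- The summand of `tuples s (suc l) t` is a `where`-bound function of Defs: it is named here by unification.
private
  tuples-unfolded : (s l t : ℕ) → Σ (ℕ → List (List ℕ)) λ F → tuples s (suc l) t ≡ concatMap F (upTo (suc t))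
  tuples-unfolded s l t = _ , refl

  tuples-unfolded-summand : ∀ s l t a → proj₁ (tuples-unfolded s l t) a ≡ branch s l t a
  tuples-unfolded-summand s l t a with s ℕ.* a ≤? t
  ... | yes _ = refl
  ... | no  _ = refl

tuples-suc : ∀ s l t → tuples s (suc l) t ≡ concatMap (branch s l t) (upTo (suc t))
tuples-suc s l t =
  trans (proj₂ (tuples-unfolded s l t)) (List.concatMap-cong (tuples-unfolded-summand s l t) (upTo (suc t)))

branch-yes : ∀ s l t a → s ℕ.* a ≤ t → branch s l t a ≡ map (a ∷_) (tuples (suc s) l (t ∸ s ℕ.* a))
branch-yes s l t a sa≤t with s ℕ.* a ≤? t
... | yes _   = refl
... | no sa≰t = contradiction sa≤t sa≰t

branch-no : ∀ s l t a → ¬ (s ℕ.* a ≤ t) → branch s l t a ≡ []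
branch-no s l t a sa≰t with s ℕ.* a ≤? t
... | yes sa≤t = contradiction sa≤t sa≰t
... | no  _    = refl

branch-1 : ∀ l c a → branch 1 l (c ℕ.+ a) a ≡ map (a ∷_) (tuples 2 l c)
branch-1 l c a = begin
  branch 1 l (c ℕ.+ a) a                              ≡⟨ branch-yes 1 l (c ℕ.+ a) a a≤c+a ⟩
  map (a ∷_) (tuples 2 l (c ℕ.+ a ∸ 1 ℕ.* a))         ≡⟨ cong (λ x → map (a ∷_) (tuples 2 l x)) c+a∸a≡c ⟩
  map (a ∷_) (tuples 2 l c)                           ∎
  where
  open ≡-Reasoning
  a≤c+a : 1 ℕ.* a ≤ c ℕ.+ a
  a≤c+a = subst (_≤ c ℕ.+ a) (sym (ℕₚ.*-identityˡ a)) (ℕₚ.m≤n+m a c)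
  c+a∸a≡c : c ℕ.+ a ∸ 1 ℕ.* a ≡ c
  c+a∸a≡c = trans (cong (c ℕ.+ a ∸_) (ℕₚ.*-identityˡ a)) (ℕₚ.m+n∸n≡m c a)

zeros : ℕ → List ℕ
zeros l = replicate l 0

total-zeros : ∀ l → total (zeros l) ≡ 0
total-zeros zero    = refl
total-zeros (suc l) = total-zeros l

weight-zeros : ∀ s l → weight s (zeros l) ≡ 1ℚ
weight-zeros s zero    = refl
weight-zeros s (suc l) = trans (cong (1ℚ *_) (weight-zeros (suc s) l)) (*-identityˡ 1ℚ)

tuples-zero : ∀ s l → tuples s l 0 ≡ [ zeros l ]
tuples-zero s zero    = refl
tuples-zero s (suc l) = begin
  tuples s (suc l) 0                                      ≡⟨ tuples-suc s l 0 ⟩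
  branch s l 0 0 ++ []                                    ≡⟨ List.++-identityʳ (branch s l 0 0) ⟩
  branch s l 0 0                                          ≡⟨ branch-yes s l 0 0 (ℕₚ.≤-reflexive (ℕₚ.*-zeroʳ s)) ⟩
  map (0 ∷_) (tuples (suc s) l (0 ∸ s ℕ.* 0))             ≡⟨ cong (λ x → map (0 ∷_) (tuples (suc s) l (0 ∸ x))) (ℕₚ.*-zeroʳ s) ⟩
  map (0 ∷_) (tuples (suc s) l 0)                         ≡⟨ cong (map (0 ∷_)) (tuples-zero (suc s) l) ⟩
  [ zeros (suc l) ]                                       ∎
  where open ≡-Reasoning

concatMap-[] : ∀ {A B : Set} (F : A → List B) xs → (∀ x → F x ≡ []) → concatMap F xs ≡ []
concatMap-[] F []       F≡[] = refl
concatMap-[] F (x ∷ xs) F≡[] rewrite F≡[] x = concatMap-[] F xs F≡[]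

tuples-empty : ∀ s l t → 0 < t → t < s → tuples s l t ≡ []
tuples-empty s zero    (suc t) _   _   = refl
tuples-empty s (suc l) t       0<t t<s = trans (tuples-suc s l t) (concatMap-[] (branch s l t) (upTo (suc t)) branch≡[])
  where
  branch≡[] : ∀ a → branch s l t a ≡ []
  branch≡[] zero    = begin
    branch s l t 0                              ≡⟨ branch-yes s l t 0 (subst (_≤ t) (sym (ℕₚ.*-zeroʳ s)) z≤n) ⟩
    map (0 ∷_) (tuples (suc s) l (t ∸ s ℕ.* 0)) ≡⟨ cong (λ x → map (0 ∷_) (tuples (suc s) l (t ∸ x))) (ℕₚ.*-zeroʳ s) ⟩
    map (0 ∷_) (tuples (suc s) l t)             ≡⟨ cong (map (0 ∷_)) (tuples-empty (suc s) l t 0<t (ℕₚ.m<n⇒m<1+n t<s)) ⟩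
    []                                          ∎
    where open ≡-Reasoning
  branch≡[] (suc a) = branch-no s l t (suc a) (λ s[1+a]≤t → ℕₚ.<⇒≱ t<s (ℕₚ.≤-trans (ℕₚ.m≤m*n s (suc a)) s[1+a]≤t))

tuples-2-2 : ∀ l → tuples 2 (suc l) 2 ≡ [ 1 ∷ zeros l ]
tuples-2-2 l rewrite tuples-empty 3 l 2 (s≤s z≤n) (ℕₚ.n<1+n 2) | tuples-zero 3 l = refl

tuples-2-3 : ∀ l → tuples 2 (2 ℕ.+ l) 3 ≡ [ 0 ∷ 1 ∷ zeros l ]
tuples-2-3 l rewrite tuples-empty 4 l 3 (s≤s z≤n) (ℕₚ.n<1+n 3) | tuples-zero 4 l
                   | tuples-empty 4 l 1 (s≤s z≤n) (s≤s (s≤s z≤n)) = refl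

tuples-2-4 : ∀ l → tuples 2 (3 ℕ.+ l) 4 ≡ (0 ∷ 0 ∷ 1 ∷ zeros l) ∷ (2 ∷ zeros (2 ℕ.+ l)) ∷ []
tuples-2-4 l rewrite tuples-empty 5 l 4 (s≤s z≤n) (ℕₚ.n<1+n 4) | tuples-zero 5 l
                   | tuples-empty 5 l 1 (s≤s z≤n) (s≤s (s≤s z≤n))
                   | tuples-empty 5 l 2 (s≤s z≤n) (s≤s (s≤s (s≤s z≤n))) = refl

mutual
  weighted-total-bound : ∀ s l t → All (λ r → s ℕ.* total r ≤ t) (tuples s l t)
  weighted-total-bound s zero    zero    = ℕₚ.≤-reflexive (ℕₚ.*-zeroʳ s) ∷ []
  weighted-total-bound s zero    (suc t) = []
  weighted-total-bound s (suc l) t       = subst (All (λ r → s ℕ.* total r ≤ t)) (sym (tuples-suc s l t))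
    (All.concat⁺ (All.map⁺ (All.universal (branch-weighted-total-bound s l t) (upTo (suc t)))))

  branch-weighted-total-bound : ∀ s l t a → All (λ r → s ℕ.* total r ≤ t) (branch s l t a)
  branch-weighted-total-bound s l t a with s ℕ.* a ≤? t
  ... | no  _    = []
  ... | yes sa≤t = All.map⁺ (All.map (λ {r} → cons-bound r) (weighted-total-bound (suc s) l (t ∸ s ℕ.* a)))
    where
    cons-bound : ∀ r → suc s ℕ.* total r ≤ t ∸ s ℕ.* a → s ℕ.* (a ℕ.+ total r) ≤ t
    cons-bound r bound = begin
      s ℕ.* (a ℕ.+ total r)              ≡⟨ ℕₚ.*-distribˡ-+ s a (total r) ⟩
      s ℕ.* a ℕ.+ s ℕ.* total r          ≤⟨ ℕₚ.+-monoʳ-≤ (s ℕ.* a) (ℕₚ.m≤n+m (s ℕ.* total r) (total r)) ⟩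
      s ℕ.* a ℕ.+ suc s ℕ.* total r      ≤⟨ ℕₚ.+-monoʳ-≤ (s ℕ.* a) bound ⟩
      s ℕ.* a ℕ.+ (t ∸ s ℕ.* a)          ≡⟨ ℕₚ.m+[n∸m]≡n sa≤t ⟩
      t                                  ∎
      where open ℕₚ.≤-Reasoning

-- The coefficient as a sum over λ₁

term : ℕ → List ℕ → ℚ
term j λs = sign (total λs) * weight 1 λs * coeff j (pochhammer (total λs))

C-as-sum : ∀ k j → C k j ≡ sign k * sumℚ (map (term j) (tuples 1 k k))
C-as-sum k j = begin
  coeff j (scale (sign k) (sumP (map summand (tuples 1 k k))))   ≡⟨ coeff-scale j (sign k) (sumP (map summand (tuples 1 k k))) ⟩
  sign k * coeff j (sumP (map summand (tuples 1 k k)))           ≡⟨ cong (sign k *_) (coeff-sumP j (map summand (tuples 1 k k))) ⟩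
  sign k * sumℚ (map (coeff j) (map summand (tuples 1 k k)))     ≡⟨ cong (λ xs → sign k * sumℚ xs) (sym (List.map-∘ (tuples 1 k k))) ⟩
  sign k * sumℚ (map (coeff j ∘ summand) (tuples 1 k k))         ≡⟨ cong (λ xs → sign k * sumℚ xs) (List.map-cong coeff-summand (tuples 1 k k)) ⟩
  sign k * sumℚ (map (term j) (tuples 1 k k))                    ∎
  where
  open ≡-Reasoning
  summand : List ℕ → Poly
  summand λs = scale (sign (total λs) * weight 1 λs) (pochhammer (total λs))
  coeff-summand : ∀ λs → coeff j (summand λs) ≡ term j λs
  coeff-summand λs = coeff-scale j (sign (total λs) * weight 1 λs) (pochhammer (total λs))

term-∷ : ∀ j a r {T W N} → total r ≡ T → weight 2 r ≡ W → a ℕ.+ T ≡ N →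
         term j (a ∷ r) ≡ sign N * ((⅙ ^ℚ a * inv! a) * W) * coeff j (pochhammer N)
term-∷ j a r refl refl refl = refl

term-vanishing : ∀ j λs → total λs < j → term j λs ≡ 0ℚ
term-vanishing j λs N<j = trans (cong (sign (total λs) * weight 1 λs *_) (coeff-pochhammer-> (total λs) j N<j))
                               (*-zeroʳ (sign (total λs) * weight 1 λs))

slice : (l j a : ℕ) → ℚ
slice l j a = sumℚ (map (term j) (branch 1 l (suc l) a))

C-as-slices : ∀ l j → C (suc l) j ≡ sign (suc l) * sumℚ (map (slice l j) (upTo (2 ℕ.+ l)))
C-as-slices l j = begin
  C (suc l) j                                                             ≡⟨ C-as-sum (suc l) j ⟩
  sign (suc l) * sumℚ (map (term j) (tuples 1 (suc l) (suc l)))           ≡⟨ cong (λ xs → sign (suc l) * sumℚ (map (term j) xs)) (tuples-suc 1 l (suc l)) ⟩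
  sign (suc l) * sumℚ (map (term j) (concatMap (branch 1 l (suc l)) (upTo (2 ℕ.+ l))))
    ≡⟨ cong (sign (suc l) *_) (sumℚ-concatMap (term j) (branch 1 l (suc l)) (upTo (2 ℕ.+ l))) ⟩
  sign (suc l) * sumℚ (map (slice l j) (upTo (2 ℕ.+ l)))                  ∎
  where open ≡-Reasoning

cons-total-< : ∀ {a t T j} → a ≤ t → 2 ℕ.* T ≤ t ∸ a → a ℕ.+ t < 2 ℕ.* j → a ℕ.+ T < j
cons-total-< {a} {t} {T} {j} a≤t 2T≤t∸a a+t<2j = ℕₚ.*-cancelˡ-< 2 (a ℕ.+ T) j (begin-strict
  2 ℕ.* (a ℕ.+ T)              ≡⟨ double-+ a T ⟩
  a ℕ.+ (a ℕ.+ 2 ℕ.* T)        ≤⟨ ℕₚ.+-monoʳ-≤ a (ℕₚ.+-monoʳ-≤ a 2T≤t∸a) ⟩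
  a ℕ.+ (a ℕ.+ (t ∸ a))        ≡⟨ cong (a ℕ.+_) (ℕₚ.m+[n∸m]≡n a≤t) ⟩
  a ℕ.+ t                      <⟨ a+t<2j ⟩
  2 ℕ.* j                      ∎)
  where
  open ℕₚ.≤-Reasoning
  double-+ : ∀ a T → 2 ℕ.* (a ℕ.+ T) ≡ a ℕ.+ (a ℕ.+ 2 ℕ.* T)
  double-+ = ℕ-solve-∀

slice-vanishing : ∀ l j a → a ℕ.+ suc l < 2 ℕ.* j → slice l j a ≡ 0ℚ
slice-vanishing l j a a+t<2j = by-cases (1 ℕ.* a ≤? suc l)
  where
  total-< : 1 ℕ.* a ≤ suc l → ∀ r → 2 ℕ.* total r ≤ suc l ∸ 1 ℕ.* a → a ℕ.+ total r < j
  total-< a≤t r bound = cons-total-< (subst (_≤ suc l) (ℕₚ.*-identityˡ a) a≤t)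
                                    (subst (λ x → 2 ℕ.* total r ≤ suc l ∸ x) (ℕₚ.*-identityˡ a) bound) a+t<2j
  by-cases : Dec (1 ℕ.* a ≤ suc l) → slice l j a ≡ 0ℚ
  by-cases (no  a≰t) = cong (sumℚ ∘ map (term j)) (branch-no 1 l (suc l) a a≰t)
  by-cases (yes a≤t) = trans (cong (sumℚ ∘ map (term j)) (branch-yes 1 l (suc l) a a≤t))
    (sumℚ-all-zero (All.map⁺ (All.map⁺ (All.map (λ {r} → term-vanishing j (a ∷ r) ∘ total-< a≤t r)
      (weighted-total-bound 2 l (suc l ∸ 1 ℕ.* a))))))

-- The slices λ₁ = m, m+1, m+2, m+3, m+4 of C (4+m) (2+m), with S = sign m, P = ⅙ ^ℚ m,
-- E = inv! (4+m), y = fromℕ m, and each inv! (i+m) written as E (m+4)⋯(m+i+1).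
subsubleading-algebra : ∀ S P E y →
  (- 1ℚ * (- 1ℚ * (- 1ℚ * (- 1ℚ * S)))) *
    ((- 1ℚ * (- 1ℚ * S)) * ((P * (E * (fromℕ 4 + y) * (fromℕ 3 + y) * (fromℕ 2 + y) * (fromℕ 1 + y))) * (inv! 5 ^ℚ 2 * inv! 2)) * 1ℚ
    + ((- 1ℚ * (- 1ℚ * S)) * ((⅙ * P * (E * (fromℕ 4 + y) * (fromℕ 3 + y) * (fromℕ 2 + y))) * inv! 7) * 1ℚ
    + ((- 1ℚ * (- 1ℚ * (- 1ℚ * S))) * ((⅙ * (⅙ * P) * (E * (fromℕ 4 + y) * (fromℕ 3 + y))) * inv! 5)
        * ((fromℕ 2 + y) * (1ℚ + (fromℕ 2 + y)) * inv! 2)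
    + (0ℚ
    + ((- 1ℚ * (- 1ℚ * (- 1ℚ * (- 1ℚ * S)))) * ((⅙ * (⅙ * (⅙ * (⅙ * P))) * E) * 1ℚ)
        * ((fromℕ 2 + y) * (1ℚ + (fromℕ 2 + y)) * (1ℚ + (1ℚ + (fromℕ 2 + y))) * (fromℕ 3 * (fromℕ 2 + y) + fromℕ 5) * inv! 4)
    + 0ℚ)))))
  ≡ (S * S) * ((fromℕ 21 * (fromℕ 4 + y) + fromℕ 17) * ((+ 1) / 175) * (⅙ * (⅙ * (⅙ * (⅙ * (⅙ * P)))))
               * (E * (fromℕ 4 + y) * (fromℕ 3 + y) * (fromℕ 2 + y)))
subsubleading-algebra = solve-∀ ℚ-ring

module _ (m : ℕ) where
  private
    y E : ℚ
    y = fromℕ m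
    E = inv! (4 ℕ.+ m)
    f : ℕ → ℚ
    f i = fromℕ i + y
    slice′ : ℕ → ℚ
    slice′ = slice (3 ℕ.+ m) (2 ℕ.+ m)
    closed-form : ℚ
    closed-form = (fromℕ 21 * f 4 + fromℕ 17) * ((+ 1) / 175) * ⅙ ^ℚ (5 ℕ.+ m) * (E * f 4 * f 3 * f 2)

  inv!-3+m : inv! (3 ℕ.+ m) ≡ E * f 4
  inv!-3+m = trans (inv!-pred (3 ℕ.+ m)) (cong (E *_) (fromℕ-+ 4 m))

  inv!-2+m : inv! (2 ℕ.+ m) ≡ E * f 4 * f 3
  inv!-2+m = trans (inv!-pred (2 ℕ.+ m)) (cong₂ _*_ inv!-3+m (fromℕ-+ 3 m))

  inv!-1+m : inv! (1 ℕ.+ m) ≡ E * f 4 * f 3 * f 2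
  inv!-1+m = trans (inv!-pred (1 ℕ.+ m)) (cong₂ _*_ inv!-2+m (fromℕ-+ 2 m))

  inv!-m : inv! m ≡ E * f 4 * f 3 * f 2 * f 1
  inv!-m = trans (inv!-pred m) (cong₂ _*_ inv!-1+m (fromℕ-+ 1 m))

  slice-4+m : slice′ (4 ℕ.+ m) ≡
    sign (4 ℕ.+ m) * ((⅙ ^ℚ (4 ℕ.+ m) * E) * 1ℚ) * (f 2 * (1ℚ + f 2) * (1ℚ + (1ℚ + f 2)) * (fromℕ 3 * f 2 + fromℕ 5) * inv! 4)
  slice-4+m = begin
    slice′ (4 ℕ.+ m)
      ≡⟨ cong (sumℚ ∘ map (term (2 ℕ.+ m))) (trans (branch-1 (3 ℕ.+ m) 0 (4 ℕ.+ m)) (cong (map ((4 ℕ.+ m) ∷_)) (tuples-zero 2 (3 ℕ.+ m)))) ⟩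
    term (2 ℕ.+ m) ((4 ℕ.+ m) ∷ zeros (3 ℕ.+ m)) + 0ℚ
      ≡⟨ +-identityʳ _ ⟩
    term (2 ℕ.+ m) ((4 ℕ.+ m) ∷ zeros (3 ℕ.+ m))
      ≡⟨ term-∷ (2 ℕ.+ m) (4 ℕ.+ m) (zeros (3 ℕ.+ m)) (total-zeros (3 ℕ.+ m)) (weight-zeros 2 (3 ℕ.+ m)) (ℕₚ.+-identityʳ (4 ℕ.+ m)) ⟩
    c * coeff (2 ℕ.+ m) (pochhammer (4 ℕ.+ m))
      ≡⟨ cong (c *_) (coeff-pochhammer-subsubleading (2 ℕ.+ m)) ⟩
    c * Q (fromℕ (2 ℕ.+ m))
      ≡⟨ cong (λ x → c * Q x) (fromℕ-+ 2 m) ⟩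
    c * Q (f 2)
      ∎
    where
    open ≡-Reasoning
    c : ℚ
    c = sign (4 ℕ.+ m) * ((⅙ ^ℚ (4 ℕ.+ m) * E) * 1ℚ)
    Q : ℚ → ℚ
    Q x = x * (1ℚ + x) * (1ℚ + (1ℚ + x)) * (fromℕ 3 * x + fromℕ 5) * inv! 4

  slice-3+m : slice′ (3 ℕ.+ m) ≡ 0ℚ
  slice-3+m = cong (sumℚ ∘ map (term (2 ℕ.+ m)))
    (trans (branch-1 (3 ℕ.+ m) 1 (3 ℕ.+ m)) (cong (map ((3 ℕ.+ m) ∷_)) (tuples-empty 2 (3 ℕ.+ m) 1 (s≤s z≤n) (ℕₚ.n<1+n 1))))

  slice-2+m : slice′ (2 ℕ.+ m) ≡
    sign (3 ℕ.+ m) * ((⅙ ^ℚ (2 ℕ.+ m) * (E * f 4 * f 3)) * inv! 5) * (f 2 * (1ℚ + f 2) * inv! 2)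
  slice-2+m = begin
    slice′ (2 ℕ.+ m)
      ≡⟨ cong (sumℚ ∘ map (term (2 ℕ.+ m))) (trans (branch-1 (3 ℕ.+ m) 2 (2 ℕ.+ m)) (cong (map ((2 ℕ.+ m) ∷_)) (tuples-2-2 (2 ℕ.+ m)))) ⟩
    term (2 ℕ.+ m) λs + 0ℚ
      ≡⟨ +-identityʳ _ ⟩
    term (2 ℕ.+ m) λs
      ≡⟨ term-∷ (2 ℕ.+ m) (2 ℕ.+ m) (1 ∷ zeros (2 ℕ.+ m)) (cong suc (total-zeros (2 ℕ.+ m)))
                (cong ((inv! 5 ^ℚ 1 * inv! 1) *_) (weight-zeros 3 (2 ℕ.+ m))) (ℕₚ.+-comm (2 ℕ.+ m) 1) ⟩
    sign (3 ℕ.+ m) * ((⅙ ^ℚ (2 ℕ.+ m) * inv! (2 ℕ.+ m)) * inv! 5) * coeff (2 ℕ.+ m) (pochhammer (3 ℕ.+ m))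
      ≡⟨ cong₂ (λ u v → sign (3 ℕ.+ m) * ((⅙ ^ℚ (2 ℕ.+ m) * u) * inv! 5) * v) inv!-2+m (coeff-pochhammer-subleading (2 ℕ.+ m)) ⟩
    sign (3 ℕ.+ m) * ((⅙ ^ℚ (2 ℕ.+ m) * (E * f 4 * f 3)) * inv! 5) * (fromℕ (2 ℕ.+ m) * (1ℚ + fromℕ (2 ℕ.+ m)) * inv! 2)
      ≡⟨ cong (λ x → sign (3 ℕ.+ m) * ((⅙ ^ℚ (2 ℕ.+ m) * (E * f 4 * f 3)) * inv! 5) * (x * (1ℚ + x) * inv! 2)) (fromℕ-+ 2 m) ⟩
    sign (3 ℕ.+ m) * ((⅙ ^ℚ (2 ℕ.+ m) * (E * f 4 * f 3)) * inv! 5) * (f 2 * (1ℚ + f 2) * inv! 2)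
      ∎
    where
    open ≡-Reasoning
    λs : List ℕ
    λs = (2 ℕ.+ m) ∷ 1 ∷ zeros (2 ℕ.+ m)

  slice-1+m : slice′ (1 ℕ.+ m) ≡
    sign (2 ℕ.+ m) * ((⅙ ^ℚ (1 ℕ.+ m) * (E * f 4 * f 3 * f 2)) * inv! 7) * 1ℚ
  slice-1+m = begin
    slice′ (1 ℕ.+ m)
      ≡⟨ cong (sumℚ ∘ map (term (2 ℕ.+ m))) (trans (branch-1 (3 ℕ.+ m) 3 (1 ℕ.+ m)) (cong (map ((1 ℕ.+ m) ∷_)) (tuples-2-3 (1 ℕ.+ m)))) ⟩
    term (2 ℕ.+ m) λs + 0ℚ
      ≡⟨ +-identityʳ _ ⟩
    term (2 ℕ.+ m) λs
      ≡⟨ term-∷ (2 ℕ.+ m) (1 ℕ.+ m) (0 ∷ 1 ∷ zeros (1 ℕ.+ m)) (cong suc (total-zeros (1 ℕ.+ m)))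
                (cong (λ w → (inv! 5 ^ℚ 0 * inv! 0) * ((inv! 7 ^ℚ 1 * inv! 1) * w)) (weight-zeros 4 (1 ℕ.+ m))) (ℕₚ.+-comm (1 ℕ.+ m) 1) ⟩
    sign (2 ℕ.+ m) * ((⅙ ^ℚ (1 ℕ.+ m) * inv! (1 ℕ.+ m)) * inv! 7) * coeff (2 ℕ.+ m) (pochhammer (2 ℕ.+ m))
      ≡⟨ cong₂ (λ u v → sign (2 ℕ.+ m) * ((⅙ ^ℚ (1 ℕ.+ m) * u) * inv! 7) * v) inv!-1+m (coeff-pochhammer-leading (2 ℕ.+ m)) ⟩
    sign (2 ℕ.+ m) * ((⅙ ^ℚ (1 ℕ.+ m) * (E * f 4 * f 3 * f 2)) * inv! 7) * 1ℚ
      ∎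
    where
    open ≡-Reasoning
    λs : List ℕ
    λs = (1 ℕ.+ m) ∷ 0 ∷ 1 ∷ zeros (1 ℕ.+ m)

  slice-m : slice′ m ≡
    sign (2 ℕ.+ m) * ((⅙ ^ℚ m * (E * f 4 * f 3 * f 2 * f 1)) * (inv! 5 ^ℚ 2 * inv! 2)) * 1ℚ
  slice-m = begin
    slice′ m
      ≡⟨ cong (sumℚ ∘ map (term (2 ℕ.+ m))) (trans (branch-1 (3 ℕ.+ m) 4 m) (cong (map (m ∷_)) (tuples-2-4 m))) ⟩
    term (2 ℕ.+ m) λ₄ + (term (2 ℕ.+ m) λ₂₂ + 0ℚ)
      ≡⟨ cong₂ _+_ (term-vanishing (2 ℕ.+ m) λ₄ total-λ₄<) (+-identityʳ (term (2 ℕ.+ m) λ₂₂)) ⟩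
    0ℚ + term (2 ℕ.+ m) λ₂₂
      ≡⟨ +-identityˡ (term (2 ℕ.+ m) λ₂₂) ⟩
    term (2 ℕ.+ m) λ₂₂
      ≡⟨ term-∷ (2 ℕ.+ m) m (2 ∷ zeros (2 ℕ.+ m)) (cong (suc ∘ suc) (total-zeros (2 ℕ.+ m)))
                (trans (cong (inv! 5 ^ℚ 2 * inv! 2 *_) (weight-zeros 3 (2 ℕ.+ m))) (*-identityʳ (inv! 5 ^ℚ 2 * inv! 2)))
                (ℕₚ.+-comm m 2) ⟩
    sign (2 ℕ.+ m) * ((⅙ ^ℚ m * inv! m) * (inv! 5 ^ℚ 2 * inv! 2)) * coeff (2 ℕ.+ m) (pochhammer (2 ℕ.+ m))
      ≡⟨ cong₂ (λ u v → sign (2 ℕ.+ m) * ((⅙ ^ℚ m * u) * (inv! 5 ^ℚ 2 * inv! 2)) * v)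
               inv!-m (coeff-pochhammer-leading (2 ℕ.+ m)) ⟩
    sign (2 ℕ.+ m) * ((⅙ ^ℚ m * (E * f 4 * f 3 * f 2 * f 1)) * (inv! 5 ^ℚ 2 * inv! 2)) * 1ℚ
      ∎
    where
    open ≡-Reasoning
    λ₄ λ₂₂ : List ℕ
    λ₄  = m ∷ 0 ∷ 0 ∷ 1 ∷ zeros m
    λ₂₂ = m ∷ 2 ∷ zeros (2 ℕ.+ m)
    total-λ₄< : total λ₄ < 2 ℕ.+ m
    total-λ₄< = subst (_< 2 ℕ.+ m) (cong (m ℕ.+_) (cong suc (sym (total-zeros m)))) (ℕₚ.≤-reflexive (cong suc (ℕₚ.+-comm m 1)))

  slice-below-m : ∀ {a} → a < m → slice′ a ≡ 0ℚ
  slice-below-m {a} a<m = slice-vanishing (3 ℕ.+ m) (2 ℕ.+ m) a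
    (subst (a ℕ.+ (4 ℕ.+ m) <_) (m+[4+m]≡2*[2+m] m) (ℕₚ.+-monoˡ-< (4 ℕ.+ m) a<m))
    where
    m+[4+m]≡2*[2+m] : ∀ m → m ℕ.+ (4 ℕ.+ m) ≡ 2 ℕ.* (2 ℕ.+ m)
    m+[4+m]≡2*[2+m] = ℕ-solve-∀

  target-form : ((+ (21 ℕ.* (4 ℕ.+ m) ℕ.+ 17)) / 175) * inv6^ ((4 ℕ.+ m) ℕ.+ 1) * inv! ((4 ℕ.+ m) ∸ 3) ≡ closed-form
  target-form = begin
    ((+ n) / 175) * inv6^ ((4 ℕ.+ m) ℕ.+ 1) * inv! (1 ℕ.+ m)
      ≡⟨ cong₂ (λ u v → u * v * inv! (1 ℕ.+ m)) (n/d≡n*1/d n 174) (trans (inv6^≡⅙^ ((4 ℕ.+ m) ℕ.+ 1)) (cong (⅙ ^ℚ_) (ℕₚ.+-comm (4 ℕ.+ m) 1))) ⟩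
    fromℕ n * ((+ 1) / 175) * ⅙ ^ℚ (5 ℕ.+ m) * inv! (1 ℕ.+ m)
      ≡⟨ cong₂ (λ u v → u * ((+ 1) / 175) * ⅙ ^ℚ (5 ℕ.+ m) * v) fromℕ-n inv!-1+m ⟩
    closed-form
      ∎
    where
    open ≡-Reasoning
    n : ℕ
    n = 21 ℕ.* (4 ℕ.+ m) ℕ.+ 17
    fromℕ-n : fromℕ n ≡ fromℕ 21 * f 4 + fromℕ 17
    fromℕ-n = trans (fromℕ-+ (21 ℕ.* (4 ℕ.+ m)) 17)
                    (cong (_+ fromℕ 17) (trans (fromℕ-* 21 (4 ℕ.+ m)) (cong (fromℕ 21 *_) (fromℕ-+ 4 m))))

  C-subsubleading : C (4 ℕ.+ m) (2 ℕ.+ m) ≡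
    ((+ (21 ℕ.* (4 ℕ.+ m) ℕ.+ 17)) / 175) * inv6^ ((4 ℕ.+ m) ℕ.+ 1) * inv! ((4 ℕ.+ m) ∸ 3)
  C-subsubleading = begin
    C (4 ℕ.+ m) (2 ℕ.+ m)
      ≡⟨ C-as-slices (3 ℕ.+ m) (2 ℕ.+ m) ⟩
    sign (4 ℕ.+ m) * sumℚ (map slice′ (upTo (5 ℕ.+ m)))
      ≡⟨ cong (sign (4 ℕ.+ m) *_) (sumℚ-upTo-shift slice′ m slice-below-m 5) ⟩
    sign (4 ℕ.+ m) * (slice′ m + (slice′ (1 ℕ.+ m) + (slice′ (2 ℕ.+ m) + (slice′ (3 ℕ.+ m) + (slice′ (4 ℕ.+ m) + 0ℚ)))))
      ≡⟨ trans (cong (sign (4 ℕ.+ m) *_) (cong₂ _+_ slice-m (cong₂ _+_ slice-1+m (cong₂ _+_ slice-2+m (cong₂ _+_ slice-3+m (cong (_+ 0ℚ) slice-4+m))))))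
               (subsubleading-algebra (sign m) (⅙ ^ℚ m) E y) ⟩
    (sign m * sign m) * closed-form
      ≡⟨ cong (_* closed-form) (sign-sq m) ⟩
    1ℚ * closed-form
      ≡⟨ *-identityˡ closed-form ⟩
    closed-form
      ≡⟨ sym target-form ⟩
    ((+ (21 ℕ.* (4 ℕ.+ m) ℕ.+ 17)) / 175) * inv6^ ((4 ℕ.+ m) ℕ.+ 1) * inv! ((4 ℕ.+ m) ∸ 3)
      ∎
    where open ≡-Reasoning

mainTheorem3 : ∀ (k : ℕ) → 3 ≤ k →
    C k (k ∸ 2) ≡ ((+ (21 ℕ.* k ℕ.+ 17)) / 175) * inv6^ (k ℕ.+ 1) * inv! (k ∸ 3)
mainTheorem3 zero                      ()
mainTheorem3 (suc zero)                (s≤s ())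
mainTheorem3 (suc (suc zero))          (s≤s (s≤s ()))
mainTheorem3 (suc (suc (suc zero)))    _ = refl
mainTheorem3 (suc (suc (suc (suc m)))) _ = C-subsubleading m
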